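{- Let $m\ge 2$ and let $G$ be a voltage graph over $\mathbb{Z}_m$ with pinned vertices. Let $P$ be a path of length $\ell$ in $G$ from a pinned vertex $x^{*}$ to a different pinned vertex $y^{*}$. Then the derived graph $G_m$ contains a cycle of length $2\ell$ passing through $x^{*}$ and $y^{*}$.
   Context: A voltage graph over $\mathbb{Z}_m$ is a finite directed multigraph (loops and parallel arcs allowed) whose arcs carry labels in $\mathbb{Z}_m$; an undirected unlabelled edge means an arc with label $0$. Some vertices of degree $1$ may be designated pinned vertices. The derived graph $G_m$ is defined as follows: each non-pinned vertex $v$ gives $m$ vertices $v^0,\dots,v^{m-1}$; each pinned vertex $v^{*}$ gives a single vertex $v^{*}$; an arc from non-pinned $v$ to non-pinned $w$ with label $a$ gives the edges $v^iw^{i+a}$ for all $i\in\mathbb{Z}_m$ (indices mod $m$); an edge between a pinned vertex $v^{*}$ and a non-pinned vertex $w$ gives the edges $v^{*}w^i$ for all $i$. -}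

module Defs where

open import Data.Nat using (ℕ; zero; suc; _+_; _*_; _≤_)
open import Data.Nat.DivMod using (_mod_)
open import Data.Fin using (Fin; toℕ; inject₁; fromℕ) renaming (zero to fzero; suc to fsuc)
open import Data.Bool using (Bool; true; false)
open import Data.List using (List; map; allFin)
open import Data.Nat.ListAction using (sum)
open import Data.Product using (Σ; ∃; ∃-syntax; _×_; _,_)
open import Data.Sum using (_⊎_)
open import Data.Empty using (⊥)
open import Function.Definitions using (Injective)
open import Relation.Binary.PropositionalEquality using (_≡_)
open import Relation.Nullary using (¬_; yes; no)
open import Data.Fin using (_≟_)

_+ₘ_ : ∀ {m} → Fin m → Fin m → Fin m
_+ₘ_ {suc n} i j = (toℕ i + toℕ j) mod suc n

eqℕ : ∀ {n} → Fin n → Fin n → ℕ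
eqℕ u v with u ≟ v
... | yes _ = 1
... | no  _ = 0

-- A voltage graph over ℤ_m: a finite directed multigraph (loops and parallel
-- arcs allowed), arcs labelled in ℤ_m, with some vertices designated pinned.
record VoltageGraph (m : ℕ) : Set where
  field
    nV     : ℕ
    nA     : ℕ
    src    : Fin nA → Fin nV
    tgt    : Fin nA → Fin nV
    label  : Fin nA → Fin m
    pinned : Fin nV → Bool

  -- degree: number of arc-ends at v (a loop counts twice)
  degree : Fin nV → ℕ
  degree v = sum (map (λ a → eqℕ (src a) v + eqℕ (tgt a) v) (allFin nA))

  field
    pinned-deg1 : ∀ v → pinned v ≡ true → degree v ≡ 1
    -- the derived graph is only defined for arcs with at most one pinned end
    no-pinned-pinned : ∀ a → pinned (src a) ≡ true → pinned (tgt a) ≡ true → ⊥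

module _ {m : ℕ} (G : VoltageGraph m) where
  open VoltageGraph G

  Joins : Fin nA → Fin nV → Fin nV → Set
  Joins a u w = (src a ≡ u × tgt a ≡ w) ⊎ (src a ≡ w × tgt a ≡ u)

  record Path (ℓ : ℕ) : Set where
    field
      verts    : Fin (suc ℓ) → Fin nV
      arcs     : Fin ℓ → Fin nA
      distinct : Injective _≡_ _≡_ verts
      joins    : ∀ k → Joins (arcs k) (verts (inject₁ k)) (verts (fsuc k))
    start : Fin nV
    start = verts fzero
    end : Fin nV
    end = verts (fromℕ ℓ)

  data DVert : Set where
    lifted : (v : Fin nV) → pinned v ≡ false → Fin m → DVert
    pin    : (v : Fin nV) → pinned v ≡ true → DVert

  -- the edge(s) of G_m produced by arc a, oriented from first to second vertex
  ArcEdge : Fin nA → DVert → DVert → Set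
  ArcEdge a (lifted v _ i) (lifted w _ j) = src a ≡ v × tgt a ≡ w × j ≡ i +ₘ label a
  ArcEdge a (pin v _)      (lifted w _ j) = src a ≡ v × tgt a ≡ w
  ArcEdge a (lifted v _ i) (pin w _)      = src a ≡ v × tgt a ≡ w
  ArcEdge a (pin _ _)      (pin _ _)      = ⊥

  DAdj : DVert → DVert → Set
  DAdj p q = ∃[ a ] (ArcEdge a p q ⊎ ArcEdge a q p)

  record DCycle : Set where
    field
      n        : ℕ
      len≥3    : 3 ≤ suc n
      verts    : Fin (suc n) → DVert
      distinct : Injective _≡_ _≡_ verts
      adj      : ∀ (k : Fin n) → DAdj (verts (inject₁ k)) (verts (fsuc k))
      close    : DAdj (verts (fromℕ n)) (verts fzero)
    len : ℕ
    len = suc n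
    PassesThrough : DVert → Set
    PassesThrough p = ∃[ k ] (verts k ≡ p)

{-# OPTIONS --safe #-}
-- Write P as x* = v₀, v₁, …, v_ℓ = y*. Then ℓ ≥ 2 (pinned vertices are not adjacent), and each
-- interior vᵢ is unpinned, since it meets two different arcs of P while a pinned vertex has degree 1.
-- Summing the voltages along P gives heights hᵢ, and for c = 0, 1 the vertices vᵢ^(hᵢ + c) form a
-- lift of P from x* to y* in G_m. The two lifts share no interior vertex, as their heights differ by
-- 1 ≢ 0 (mod m); so the first lift followed by the second one reversed is a cycle of length 2ℓ.
module Submission where

open import Defs
open import Data.Nat using (ℕ; _≤_; _*_)
open import Data.Bool using (true)
open import Data.Product using (∃-syntax; _×_)
open import Relation.Binary.PropositionalEquality using (_≡_; _≢_)

open import Data.Nat using (zero; suc; _+_; _∸_; _<_; z≤n; s≤s; s≤s⁻¹; z<s; _≤?_; _%_; NonZero)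
open import Data.Nat.Properties
open import Data.Nat.DivMod using (_mod_; m%n<n; [m+n]%n≡m%n; %-distribˡ-+; m%n%n≡m%n; m<n⇒m%n≡m; n%n≡0)
open import Data.Fin using (Fin; toℕ; inject₁; fromℕ; fromℕ<) renaming (zero to fzero; suc to fsuc)
import Data.Fin as Fin
open import Data.Fin.Properties using (toℕ-fromℕ<; toℕ-injective; toℕ-inject₁; toℕ-fromℕ; toℕ<n)
open import Data.Bool using (Bool; false)
import Data.Bool as Bool
open import Data.List using (tabulate)
open import Data.List.Properties using (map-tabulate)
open import Data.Nat.ListAction using (sum)
open import Data.Product using (_,_)
open import Data.Sum using (_⊎_; inj₁; inj₂)
open import Data.Empty using (⊥; ⊥-elim)
open import Function using (id)
open import Relation.Binary.Core using (Rel)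
open import Relation.Binary.Definitions using (Symmetric; tri<; tri≈; tri>)
open import Relation.Nullary using (yes; no)
open import Relation.Binary.PropositionalEquality using (refl; sym; trans; cong; subst; subst₂; module ≡-Reasoning)
open import Axiom.UniquenessOfIdentityProofs using (module Decidable⇒UIP)

open Decidable⇒UIP Bool._≟_ using () renaming (≡-irrelevant to Bool-irrelevant)

Injective≤ : {A : Set} → ℕ → (ℕ → A) → Set
Injective≤ n f = ∀ {i j} → i ≤ n → j ≤ n → f i ≡ f j → i ≡ j

reverse : {A : Set} → ℕ → (ℕ → A) → ℕ → A
reverse n f i = f (n ∸ i)

reverse-injective≤ : ∀ {A : Set} {n} {f : ℕ → A} → Injective≤ n f → Injective≤ n (reverse n f)
reverse-injective≤ {n = n} inj {i} {j} i≤n j≤n e = ∸-cancelˡ-≡ i≤n j≤n (inj (m∸n≤m n i) (m∸n≤m n j) e)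

concatAt : {A : Set} → ℕ → (ℕ → A) → (ℕ → A) → ℕ → A
concatAt n f g i with i ≤? n
... | yes _ = f i
... | no  _ = g (i ∸ n)

concatAt-≤ : ∀ {A : Set} {n i} (f g : ℕ → A) → i ≤ n → concatAt n f g i ≡ f i
concatAt-≤ {n = n} {i} f g i≤n with i ≤? n
... | yes _   = refl
... | no  i≰n = ⊥-elim (i≰n i≤n)

concatAt-> : ∀ {A : Set} {n i} (f g : ℕ → A) → n < i → concatAt n f g i ≡ g (i ∸ n)
concatAt-> {n = n} {i} f g n<i with i ≤? n
... | yes i≤n = ⊥-elim (<⇒≱ n<i i≤n)
... | no  _   = refl

n≤m⇒m<n+o⇒m∸n<o : ∀ {m n o} → n ≤ m → m < n + o → m ∸ n < o
n≤m⇒m<n+o⇒m∸n<o {m} {n} {o} n≤m m< = subst (m ∸ n <_) (m+n∸m≡n n o) (∸-monoˡ-< m< n≤m)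

concatAt-injective : ∀ {A : Set} {n n′} {f g : ℕ → A} → Injective≤ n f → Injective≤ n′ g
                   → (∀ {i t} → i ≤ n → 0 < t → t < n′ → f i ≢ g t)
                   → ∀ {i j} → i < n + n′ → j < n + n′ → concatAt n f g i ≡ concatAt n f g j → i ≡ j
concatAt-injective {n = n} f-inj g-inj disjoint {i} {j} i< j< e with i ≤? n | j ≤? n
... | yes i≤n | yes j≤n = f-inj i≤n j≤n e
... | yes i≤n | no  j≰n = ⊥-elim (disjoint i≤n (m<n⇒0<n∸m (≰⇒> j≰n)) (n≤m⇒m<n+o⇒m∸n<o (≰⇒≥ j≰n) j<) e)
... | no  i≰n | yes j≤n = ⊥-elim (disjoint j≤n (m<n⇒0<n∸m (≰⇒> i≰n)) (n≤m⇒m<n+o⇒m∸n<o (≰⇒≥ i≰n) i<) (sym e))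
... | no  i≰n | no  j≰n = ∸-cancelʳ-≡ (≰⇒≥ i≰n) (≰⇒≥ j≰n)
      (g-inj (<⇒≤ (n≤m⇒m<n+o⇒m∸n<o (≰⇒≥ i≰n) i<)) (<⇒≤ (n≤m⇒m<n+o⇒m∸n<o (≰⇒≥ j≰n) j<)) e)

IsWalk : {A : Set} → Rel A _ → ℕ → (ℕ → A) → Set
IsWalk R n f = ∀ {i} → i < n → R (f i) (f (suc i))

reverse-walk : ∀ {A : Set} {R : Rel A _} {n f} → Symmetric R → IsWalk R n f → IsWalk R n (reverse n f)
reverse-walk {R = R} {n} {f} R-sym walk {i} i<n =
  subst (λ k → R (f k) (f (n ∸ suc i))) (sym (+-∸-assoc 1 i<n)) (R-sym (walk (∸-monoʳ-< z<s i<n)))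

concatAt-walk : ∀ {A : Set} {R : Rel A _} {n n′ f g} → f n ≡ g 0
              → IsWalk R n f → IsWalk R n′ g → IsWalk R (n + n′) (concatAt n f g)
concatAt-walk {R = R} {n} {n′} {f} {g} join f-walk g-walk {i} i< with <-cmp i n
... | tri< i<n _ _ = subst₂ R (sym (concatAt-≤ f g (<⇒≤ i<n))) (sym (concatAt-≤ f g i<n)) (f-walk i<n)
... | tri≈ _ refl _ = subst₂ R (trans (sym join) (sym (concatAt-≤ f g ≤-refl)))
                              (sym (trans (concatAt-> f g (n<1+n i)) (cong g (m+n∸n≡m 1 i))))
                              (g-walk (+-cancelˡ-< i 0 n′ (subst (_< i + n′) (sym (+-identityʳ i)) i<)))
... | tri> _ _ n<i = subst₂ R (sym (concatAt-> f g n<i))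
                              (trans (cong g (sym (+-∸-assoc 1 (<⇒≤ n<i)))) (sym (concatAt-> f g (m<n⇒m<1+n n<i))))
                              (g-walk (n≤m⇒m<n+o⇒m∸n<o (<⇒≤ n<i) i<))

clamp : (n : ℕ) → ℕ → Fin (suc n)
clamp zero    _       = fzero
clamp (suc n) zero    = fzero
clamp (suc n) (suc i) = fsuc (clamp n i)

toℕ-clamp : ∀ {n i} → i ≤ n → toℕ (clamp n i) ≡ i
toℕ-clamp {zero}  {zero}  _         = refl
toℕ-clamp {suc n} {zero}  _         = refl
toℕ-clamp {suc n} {suc i} (s≤s i≤n) = cong suc (toℕ-clamp i≤n)

inject₁-clamp : ∀ {n i} → i ≤ n → inject₁ (clamp n i) ≡ clamp (suc n) i
inject₁-clamp {zero}  {zero}  _         = refl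
inject₁-clamp {suc n} {zero}  _         = refl
inject₁-clamp {suc n} {suc i} (s≤s i≤n) = cong fsuc (inject₁-clamp i≤n)

clamp-self : ∀ n → clamp n n ≡ fromℕ n
clamp-self zero    = refl
clamp-self (suc n) = cong fsuc (clamp-self n)

≤-sum-tabulate : ∀ {n} (f : Fin n → ℕ) i → f i ≤ sum (tabulate f)
≤-sum-tabulate f fzero    = m≤m+n _ _
≤-sum-tabulate f (fsuc i) = ≤-trans (≤-sum-tabulate (λ k → f (fsuc k)) i) (m≤n+m _ (f fzero))

+-≤-sum-tabulate : ∀ {n} (f : Fin n → ℕ) {i j} → i ≢ j → f i + f j ≤ sum (tabulate f)
+-≤-sum-tabulate f {fzero}  {fzero}  i≢j = ⊥-elim (i≢j refl)
+-≤-sum-tabulate f {fzero}  {fsuc j} _   = +-monoʳ-≤ (f fzero) (≤-sum-tabulate (λ k → f (fsuc k)) j)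
+-≤-sum-tabulate f {fsuc i} {fzero}  _   =
  subst (_≤ sum (tabulate f)) (+-comm (f fzero) (f (fsuc i)))
        (+-monoʳ-≤ (f fzero) (≤-sum-tabulate (λ k → f (fsuc k)) i))
+-≤-sum-tabulate f {fsuc i} {fsuc j} i≢j =
  ≤-trans (+-≤-sum-tabulate (λ k → f (fsuc k)) (λ i≡j → i≢j (cong fsuc i≡j))) (m≤n+m _ (f fzero))

toℕ-mod : ∀ h n .{{_ : NonZero n}} → toℕ (h mod n) ≡ h % n
toℕ-mod h n = toℕ-fromℕ< (m%n<n h n)

%≡⇒mod≡ : ∀ h h′ n .{{_ : NonZero n}} → h % n ≡ h′ % n → h mod n ≡ h′ mod n
%≡⇒mod≡ h h′ n e = toℕ-injective (trans (toℕ-mod h n) (trans e (sym (toℕ-mod h′ n))))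

[m%n+o]%n≡[m+o]%n : ∀ m o n .{{_ : NonZero n}} → (m % n + o) % n ≡ (m + o) % n
[m%n+o]%n≡[m+o]%n m o n = begin
  (m % n + o) % n         ≡⟨ %-distribˡ-+ (m % n) o n ⟩
  (m % n % n + o % n) % n ≡⟨ cong (λ k → (k + o % n) % n) (m%n%n≡m%n m n) ⟩
  (m % n + o % n) % n     ≡⟨ %-distribˡ-+ m o n ⟨
  (m + o) % n             ∎
  where open ≡-Reasoning

mod-+ₘ : ∀ {n} h (a : Fin (suc n)) → (h + toℕ a) mod suc n ≡ (h mod suc n) +ₘ a
mod-+ₘ {n} h a = %≡⇒mod≡ (h + toℕ a) (toℕ (h mod suc n) + toℕ a) (suc n) (begin
  (h + toℕ a) % suc n                 ≡⟨ [m%n+o]%n≡[m+o]%n h (toℕ a) (suc n) ⟨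
  (h % suc n + toℕ a) % suc n         ≡⟨ cong (λ k → (k + toℕ a) % suc n) (toℕ-mod h (suc n)) ⟨
  (toℕ (h mod suc n) + toℕ a) % suc n ∎)
  where open ≡-Reasoning

mod-∸-+ₘ : ∀ {n} h (a : Fin (suc n)) → h mod suc n ≡ ((h + (suc n ∸ toℕ a)) mod suc n) +ₘ a
mod-∸-+ₘ {n} h a = begin
  h mod N                             ≡⟨ %≡⇒mod≡ (h + N) h N ([m+n]%n≡m%n h N) ⟨
  (h + N) mod N                       ≡⟨ cong (λ k → (h + k) mod N) (m∸n+n≡m (<⇒≤ (toℕ<n a))) ⟨
  (h + (N ∸ toℕ a + toℕ a)) mod N     ≡⟨ cong (_mod N) (+-assoc h _ _) ⟨
  (h + (N ∸ toℕ a) + toℕ a) mod N     ≡⟨ mod-+ₘ (h + (N ∸ toℕ a)) a ⟩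
  ((h + (N ∸ toℕ a)) mod N) +ₘ a      ∎
  where
  N = suc n
  open ≡-Reasoning

suc-mod≢mod : ∀ {n} h → suc h mod suc (suc n) ≢ h mod suc (suc n)
suc-mod≢mod {n} h e = suc%≢ (m%n<n h N) (begin
  suc (h % N) % N   ≡⟨ cong (_% N) (+-comm 1 (h % N)) ⟩
  (h % N + 1) % N   ≡⟨ [m%n+o]%n≡[m+o]%n h 1 N ⟩
  (h + 1) % N       ≡⟨ cong (_% N) (+-comm h 1) ⟩
  suc h % N         ≡⟨ toℕ-mod (suc h) N ⟨
  toℕ (suc h mod N) ≡⟨ cong toℕ e ⟩
  toℕ (h mod N)     ≡⟨ toℕ-mod h N ⟩
  h % N             ∎)
  where
  N = suc (suc n)
  open ≡-Reasoning
  suc%≢ : ∀ {x} → x < N → suc x % N ≢ x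
  suc%≢ x<N with m≤n⇒m<n∨m≡n x<N
  ... | inj₁ 1+x<N = λ e′ → 1+n≢n (trans (sym (m<n⇒m%n≡m 1+x<N)) e′)
  ... | inj₂ refl  = λ e′ → 0≢1+n (trans (sym (n%n≡0 N)) e′)

eqℕ-refl : ∀ {n} (u : Fin n) → eqℕ u u ≡ 1
eqℕ-refl u with u Fin.≟ u
... | yes _   = refl
... | no  u≢u = ⊥-elim (u≢u refl)

module _ {m : ℕ} (G : VoltageGraph m) where
  open VoltageGraph G

  DAdj-sym : Symmetric (DAdj G)
  DAdj-sym (a , inj₁ e) = a , inj₂ e
  DAdj-sym (a , inj₂ e) = a , inj₁ e

  Incident : Fin nA → Fin nV → Set
  Incident a v = src a ≡ v ⊎ tgt a ≡ v

  incidence : Fin nA → Fin nV → ℕ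
  incidence a v = eqℕ (src a) v + eqℕ (tgt a) v

  incidence-pos : ∀ {a v} → Incident a v → 1 ≤ incidence a v
  incidence-pos {a} (inj₁ refl) = subst (λ k → 1 ≤ k + eqℕ (tgt a) (src a)) (sym (eqℕ-refl (src a))) (s≤s z≤n)
  incidence-pos {a} (inj₂ refl) = subst (λ k → 1 ≤ eqℕ (src a) (tgt a) + k) (sym (eqℕ-refl (tgt a))) (m≤n+m 1 _)

  pinned-incident-unique : ∀ {v a b} → pinned v ≡ true → Incident a v → Incident b v → a ≡ b
  pinned-incident-unique {v} {a} {b} v-pinned a∋v b∋v with a Fin.≟ b
  ... | yes a≡b = a≡b
  ... | no  a≢b = ⊥-elim (1+n≰n (begin
    2                                   ≤⟨ +-mono-≤ (incidence-pos a∋v) (incidence-pos b∋v) ⟩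
    incidence a v + incidence b v       ≤⟨ +-≤-sum-tabulate (λ c → incidence c v) a≢b ⟩
    sum (tabulate (λ c → incidence c v)) ≡⟨ cong sum (map-tabulate id (λ c → incidence c v)) ⟨
    degree v                            ≡⟨ pinned-deg1 v v-pinned ⟩
    1                                   ∎))
    where open ≤-Reasoning

  Joins⇒Incidentˡ : ∀ {a u w} → Joins G a u w → Incident a u
  Joins⇒Incidentˡ (inj₁ (s , _)) = inj₁ s
  Joins⇒Incidentˡ (inj₂ (_ , t)) = inj₂ t

  Joins⇒Incidentʳ : ∀ {a u w} → Joins G a u w → Incident a w
  Joins⇒Incidentʳ (inj₁ (_ , t)) = inj₂ t
  Joins⇒Incidentʳ (inj₂ (s , _)) = inj₁ s

  Joins-consecutive : ∀ {a u v w} → Joins G a u v → Joins G a v w → u ≡ v ⊎ u ≡ w ⊎ v ≡ w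
  Joins-consecutive (inj₁ (s , _)) (inj₁ (s′ , _)) = inj₁ (trans (sym s) s′)
  Joins-consecutive (inj₁ (s , _)) (inj₂ (s′ , _)) = inj₂ (inj₁ (trans (sym s) s′))
  Joins-consecutive (inj₂ (_ , t)) (inj₁ (_ , t′)) = inj₂ (inj₁ (trans (sym t) t′))
  Joins-consecutive (inj₂ (_ , t)) (inj₂ (_ , t′)) = inj₁ (trans (sym t) t′)

  pinned-nonadjacent : ∀ {a u w} → Joins G a u w → pinned u ≡ true → pinned w ≡ true → ⊥
  pinned-nonadjacent {a} (inj₁ (refl , refl)) pu pw = no-pinned-pinned a pu pw
  pinned-nonadjacent {a} (inj₂ (refl , refl)) pu pw = no-pinned-pinned a pw pu

  Joins-forward : ∀ {a u w} → Joins G a u w → src a ≡ u → tgt a ≡ w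
  Joins-forward (inj₁ (_ , t)) _  = t
  Joins-forward (inj₂ (s , t)) s′ = trans t (trans (sym s′) s)

  Joins-backward : ∀ {a u w} → Joins G a u w → src a ≢ u → src a ≡ w × tgt a ≡ u
  Joins-backward (inj₁ (s , _)) src≢u = ⊥-elim (src≢u s)
  Joins-backward (inj₂ st)      _     = st

  -- Traversing a against its direction picks up −label a, represented in ℕ as m ∸ label a.
  voltageFrom : Fin nA → Fin nV → ℕ
  voltageFrom a u with src a Fin.≟ u
  ... | yes _ = toℕ (label a)
  ... | no  _ = m ∸ toℕ (label a)

  module PathIndexing {n : ℕ} (P : Path G (suc n)) where
    open Path P

    vertex : ℕ → Fin nV
    vertex i = verts (clamp (suc n) i)

    arc : ℕ → Fin nA
    arc i = arcs (clamp n i)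

    vertex-injective : Injective≤ (suc n) vertex
    vertex-injective i≤ j≤ e = trans (sym (toℕ-clamp i≤)) (trans (cong toℕ (distinct e)) (toℕ-clamp j≤))

    vertex-end : vertex (suc n) ≡ end
    vertex-end = cong verts (clamp-self (suc n))

    arc-joins : ∀ {i} → i < suc n → Joins G (arc i) (vertex i) (vertex (suc i))
    arc-joins {i} i< = subst (λ v → Joins G (arc i) v (vertex (suc i)))
                             (cong verts (inject₁-clamp (s≤s⁻¹ i<))) (joins (clamp n i))

    interior-unpinned : ∀ {i} → 0 < i → i < suc n → pinned (vertex i) ≡ false
    interior-unpinned {suc j} _ j+1< with pinned (vertex (suc j)) in v-pinned
    ... | false = refl
    ... | true  = ⊥-elim (no-backtrack (Joins-consecutive before (subst (λ a → Joins G a _ _) (sym same-arc) after)))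
      where
      j< : j < suc n
      j< = <-trans (n<1+n j) j+1<
      before : Joins G (arc j) (vertex j) (vertex (suc j))
      before = arc-joins j<
      after : Joins G (arc (suc j)) (vertex (suc j)) (vertex (suc (suc j)))
      after = arc-joins j+1<
      same-arc : arc j ≡ arc (suc j)
      same-arc = pinned-incident-unique v-pinned (Joins⇒Incidentʳ before) (Joins⇒Incidentˡ after)
      no-backtrack : vertex j ≡ vertex (suc j) ⊎ vertex j ≡ vertex (suc (suc j)) ⊎ vertex (suc j) ≡ vertex (suc (suc j)) → ⊥
      no-backtrack (inj₁ e)        = <⇒≢ (n<1+n j) (vertex-injective (<⇒≤ j<) (<⇒≤ j+1<) e)
      no-backtrack (inj₂ (inj₁ e)) = <⇒≢ (m<n⇒m<1+n (n<1+n j)) (vertex-injective (<⇒≤ j<) j+1< e)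
      no-backtrack (inj₂ (inj₂ e)) = <⇒≢ (n<1+n (suc j)) (vertex-injective (<⇒≤ j+1<) j+1< e)

  closedWalk⇒cycle : ∀ N (f : ℕ → DVert G) → 3 ≤ N → IsWalk (DAdj G) N f → f N ≡ f 0
                   → (∀ {i j} → i < N → j < N → f i ≡ f j → i ≡ j)
                   → ∃[ C ] (DCycle.len {G = G} C ≡ N × (∀ {i} → i < N → DCycle.PassesThrough C (f i)))
  closedWalk⇒cycle (suc n) f 3≤N walk closes inj = C , refl , passes
    where
    C : DCycle G
    C = record
      { n        = n
      ; len≥3    = 3≤N
      ; verts    = λ k → f (toℕ k)
      ; distinct = λ {k} {k′} e → toℕ-injective (inj (toℕ<n k) (toℕ<n k′) e)
      ; adj      = λ k → subst (λ i → DAdj G (f i) (f (suc (toℕ k)))) (sym (toℕ-inject₁ k))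
                               (walk (m<n⇒m<1+n (toℕ<n k)))
      ; close    = subst₂ (DAdj G) (cong f (sym (toℕ-fromℕ n))) closes (walk (n<1+n n))
      }
    passes : ∀ {i} → i < suc n → DCycle.PassesThrough C (f i)
    passes i< = fromℕ< i< , cong f (toℕ-fromℕ< i<)

  liftAt : (v : Fin nV) (b : Bool) → pinned v ≡ b → Fin m → DVert G
  liftAt v false e x = lifted v e x
  liftAt v true  e _ = pin v e

  -- The vertex v^x of G_m; a pinned vertex has a single lift, whatever x is.
  lift : Fin nV → Fin m → DVert G
  lift v = liftAt v (pinned v) refl

  base : DVert G → Fin nV
  base (lifted v _ _) = v
  base (pin v _)      = v

  base-lift : ∀ v x → base (lift v x) ≡ v
  base-lift v x = base-liftAt (pinned v) refl
    where
    base-liftAt : ∀ b (e : pinned v ≡ b) → base (liftAt v b e x) ≡ v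
    base-liftAt false _ = refl
    base-liftAt true  _ = refl

  lift-pinned : ∀ {v x} (e : pinned v ≡ true) → lift v x ≡ pin v e
  lift-pinned {v} {x} e = liftAt-pinned (pinned v) refl
    where
    liftAt-pinned : ∀ b (e′ : pinned v ≡ b) → liftAt v b e′ x ≡ pin v e
    liftAt-pinned true  e′ = cong (pin v) (Bool-irrelevant e′ e)
    liftAt-pinned false e′ with trans (sym e′) e
    ... | ()

  lift-unpinned : ∀ {v x} (e : pinned v ≡ false) → lift v x ≡ lifted v e x
  lift-unpinned {v} {x} e = liftAt-unpinned (pinned v) refl
    where
    liftAt-unpinned : ∀ b (e′ : pinned v ≡ b) → liftAt v b e′ x ≡ lifted v e x
    liftAt-unpinned false e′ = cong (λ e″ → lifted v e″ x) (Bool-irrelevant e′ e)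
    liftAt-unpinned true  e′ with trans (sym e′) e
    ... | ()

  lift-injective : ∀ {v x y} → pinned v ≡ false → lift v x ≡ lift v y → x ≡ y
  lift-injective e x↑≡y↑ with trans (sym (lift-unpinned e)) (trans x↑≡y↑ (lift-unpinned e))
  ... | refl = refl

module _ {n : ℕ} (G : VoltageGraph (suc n)) where
  open VoltageGraph G

  arcEdge-lift : ∀ a {x y} → y ≡ x +ₘ label a → ArcEdge G a (lift G (src a) x) (lift G (tgt a) y)
  arcEdge-lift a {x} {y} y≡x+a = arcEdge-liftAt (pinned (src a)) refl (pinned (tgt a)) refl
    where
    arcEdge-liftAt : ∀ bs (es : pinned (src a) ≡ bs) bt (et : pinned (tgt a) ≡ bt)
                   → ArcEdge G a (liftAt G (src a) bs es x) (liftAt G (tgt a) bt et y)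
    arcEdge-liftAt false _  false _  = refl , refl , y≡x+a
    arcEdge-liftAt false _  true  _  = refl , refl
    arcEdge-liftAt true  _  false _  = refl , refl
    arcEdge-liftAt true  es true  et = no-pinned-pinned a es et

  lift-step : ∀ {a u w} → Joins G a u w → ∀ h
            → DAdj G (lift G u (h mod suc n)) (lift G w ((h + voltageFrom G a u) mod suc n))
  lift-step {a} {u} {w} a∶u-w h with src a Fin.≟ u
  ... | yes s = a , inj₁ (subst₂ (ArcEdge G a) (cong (λ v → lift G v _) s)
                                 (cong (λ v → lift G v _) (Joins-forward G a∶u-w s))
                                 (arcEdge-lift a (mod-+ₘ h (label a))))
  ... | no  s≢u with Joins-backward G a∶u-w s≢u
  ...   | s , t = a , inj₂ (subst₂ (ArcEdge G a) (cong (λ v → lift G v _) s) (cong (λ v → lift G v _) t)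
                                   (arcEdge-lift a (mod-∸-+ₘ h (label a))))

module LiftedPaths {k : ℕ} (G : VoltageGraph (suc (suc k))) {n : ℕ} (P : Path G (suc (suc n)))
                   (x-pinned : VoltageGraph.pinned G (Path.start P) ≡ true)
                   (y-pinned : VoltageGraph.pinned G (Path.end P) ≡ true) where
  open VoltageGraph G
  open PathIndexing G P

  L : ℕ
  L = suc (suc n)

  height : ℕ → ℕ
  height zero    = 0
  height (suc i) = height i + voltageFrom G (arc i) (vertex i)

  liftedPath : ℕ → ℕ → DVert G
  liftedPath c i = lift G (vertex i) ((c + height i) mod suc (suc k))

  liftedPath-walk : ∀ c → IsWalk (DAdj G) L (liftedPath c)
  liftedPath-walk c {i} i<L =
    subst (λ h → DAdj G (liftedPath c i) (lift G (vertex (suc i)) (h mod suc (suc k))))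
          (+-assoc c (height i) _) (lift-step G (arc-joins i<L) (c + height i))

  base-liftedPath : ∀ c i → base G (liftedPath c i) ≡ vertex i
  base-liftedPath c i = base-lift G (vertex i) _

  liftedPath-injective : ∀ c → Injective≤ L (liftedPath c)
  liftedPath-injective c {i} {j} i≤L j≤L e =
    vertex-injective i≤L j≤L (trans (sym (base-liftedPath c i)) (trans (cong (base G) e) (base-liftedPath c j)))

  liftedPath-start : ∀ c → liftedPath c 0 ≡ pin (Path.start P) x-pinned
  liftedPath-start c = lift-pinned G x-pinned

  liftedPath-end : ∀ c → liftedPath c L ≡ pin (Path.end P) y-pinned
  liftedPath-end c = trans (cong (λ v → lift G v ((c + height L) mod suc (suc k))) vertex-end) (lift-pinned G y-pinned)

  liftedPaths-internally-disjoint : ∀ {i j} → i ≤ L → 0 < j → j < L → liftedPath 0 i ≢ liftedPath 1 j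
  liftedPaths-internally-disjoint {i} {j} i≤L 0<j j<L e =
    suc-mod≢mod (height j) (sym (lift-injective G (interior-unpinned 0<j j<L) same-height))
    where
    i≡j : i ≡ j
    i≡j = vertex-injective i≤L (<⇒≤ j<L)
            (trans (sym (base-liftedPath 0 i)) (trans (cong (base G) e) (base-liftedPath 1 j)))
    same-height : liftedPath 0 j ≡ liftedPath 1 j
    same-height = subst (λ k → liftedPath 0 k ≡ liftedPath 1 j) i≡j e

  cycle : ∃[ C ] (DCycle.len {G = G} C ≡ 2 * L
                 × DCycle.PassesThrough C (pin (Path.start P) x-pinned)
                 × DCycle.PassesThrough C (pin (Path.end P) y-pinned))
  cycle =
    let C , len≡2L , passes = closedWalk⇒cycle G (L + L) f 3≤2L walk closes
                                (concatAt-injective (liftedPath-injective 0)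
                                                    (reverse-injective≤ (liftedPath-injective 1)) disjoint)
    in C , trans len≡2L (cong (L +_) (sym (+-identityʳ L)))
         , subst (DCycle.PassesThrough C) (trans (concatAt-≤ {n = L} p r z≤n) (liftedPath-start 0)) (passes {0} z<s)
         , subst (DCycle.PassesThrough C) (trans (concatAt-≤ p r ≤-refl) (liftedPath-end 0)) (passes {L} L<2L)
    where
    p r f : ℕ → DVert G
    p = liftedPath 0
    r = reverse L (liftedPath 1)
    f = concatAt L p r

    L<2L : L < L + L
    L<2L = m<m+n L z<s

    3≤2L : 3 ≤ L + L
    3≤2L = ≤-trans (s≤s (s≤s (s≤s z≤n))) L<2L

    walk : IsWalk (DAdj G) (L + L) f
    walk = concatAt-walk {R = DAdj G} {f = p} {g = r} (trans (liftedPath-end 0) (sym (liftedPath-end 1)))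
                         (liftedPath-walk 0) (reverse-walk {R = DAdj G} (DAdj-sym G) (liftedPath-walk 1))

    closes : f (L + L) ≡ f 0
    closes = begin
      f (L + L)            ≡⟨ concatAt-> p r L<2L ⟩
      r (L + L ∸ L)        ≡⟨ cong r (m+n∸m≡n L L) ⟩
      liftedPath 1 (L ∸ L) ≡⟨ cong (liftedPath 1) (n∸n≡0 L) ⟩
      liftedPath 1 0       ≡⟨ trans (liftedPath-start 1) (sym (liftedPath-start 0)) ⟩
      p 0                  ≡⟨ concatAt-≤ {n = L} p r z≤n ⟨
      f 0                  ∎
      where open ≡-Reasoning

    disjoint : ∀ {i t} → i ≤ L → 0 < t → t < L → p i ≢ r t
    disjoint {t = t} i≤L 0<t t<L =
      liftedPaths-internally-disjoint {j = L ∸ t} i≤L (m<n⇒0<n∸m t<L) (∸-monoʳ-< 0<t (<⇒≤ t<L))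

lemma2 : ∀ (m : ℕ) → 2 ≤ m → (G : VoltageGraph m) → (ℓ : ℕ) → (P : Path G ℓ)
    → (px : VoltageGraph.pinned G (Path.start P) ≡ true)
    → (py : VoltageGraph.pinned G (Path.end P) ≡ true)
    → Path.start P ≢ Path.end P
    → ∃[ C ] (DCycle.len {G = G} C ≡ 2 * ℓ
    × DCycle.PassesThrough C (pin (Path.start P) px)
    × DCycle.PassesThrough C (pin (Path.end P) py))
lemma2 _ (s≤s (s≤s z≤n)) G zero          P px py x≢y = ⊥-elim (x≢y refl)
lemma2 _ (s≤s (s≤s z≤n)) G (suc zero)    P px py _   = ⊥-elim (pinned-nonadjacent G (Path.joins P fzero) px py)
lemma2 _ (s≤s (s≤s z≤n)) G (suc (suc n)) P px py _   = LiftedPaths.cycle G P px py
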